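{- For every rational $u$, let $p = u(4u^4+9u^2+4)$, $q = 4u^4+9u^2+6$, $r = u(4u^4+9u^2+6)$, $s = 4(u^2+1)$ and $a = u^2+\tfrac94$. Then $pq(p^2+q^2) = a\,rs(r^2+s^2)$; equivalently $A=p+q$, $B=r-s$, $C=p-q$, $D=r+s$ satisfy $A^4 + aB^4 = C^4 + aD^4$. -}

module Defs where

open import Data.Rational using (ℚ; _+_; _*_; _-_; _/_)
open import Data.Nat using (ℕ)
open import Data.Integer using (+_)

c : ℕ → ℚ
c n = (+ n) / 1

sq : ℚ → ℚ
sq x = x * x

pow4 : ℚ → ℚ
pow4 x = sq x * sq x

pP : ℚ → ℚ
pP u = u * (c 4 * pow4 u + c 9 * sq u + c 4)

qQ : ℚ → ℚ
qQ u = c 4 * pow4 u + c 9 * sq u + c 6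

rR : ℚ → ℚ
rR u = u * (c 4 * pow4 u + c 9 * sq u + c 6)

sS : ℚ → ℚ
sS u = c 4 * (sq u + c 1)

aA : ℚ → ℚ
aA u = sq u + (+ 9) / 4

module Submission where

-- The two identities of the theorem are not independent.  For any x, y,
--
--     (x + y)⁴ − (x − y)⁴ = 8·x·y·(x² + y²),
--
-- so for any a the quartic relation (p+q)⁴ + a(r−s)⁴ = (p−q)⁴ + a(r+s)⁴
-- is equivalent to p·q·(p² + q²) = a·r·s·(r² + s²).

open import Defs
open import Data.Rational using (ℚ; _+_; _*_; _-_; _/_)
open import Data.Integer using (+_)
open import Data.Rational.Solver using (module +-*-Solver)
open import Data.Product using (_×_; _,_)
open import Relation.Binary.PropositionalEquality using (_≡_; refl; cong; sym; module ≡-Reasoning)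

open +-*-Solver

fourthPowerDifference : (x y : ℚ) →
  pow4 (x + y) ≡ pow4 (x - y) + c 8 * (x * y * (sq x + sq y))
fourthPowerDifference = solve 2 (λ x y →
    let pow4′ = λ t → (t :* t) :* (t :* t)
    in pow4′ (x :+ y) := pow4′ (x :- y) :+ con (c 8) :* (x :* y :* (x :* x :+ y :* y)))
  refl

quarticFromCubic : (p q r s a : ℚ) →
  p * q * (sq p + sq q) ≡ a * r * s * (sq r + sq s) →
  pow4 (p + q) + a * pow4 (r - s) ≡ pow4 (p - q) + a * pow4 (r + s)
quarticFromCubic p q r s a cubic = begin
  pow4 (p + q) + a * pow4 (r - s)
    ≡⟨ cong (_+ a * pow4 (r - s)) (fourthPowerDifference p q) ⟩
  pow4 (p - q) + c 8 * (p * q * (sq p + sq q)) + a * pow4 (r - s)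
    ≡⟨ cong (λ t → pow4 (p - q) + c 8 * t + a * pow4 (r - s)) cubic ⟩
  pow4 (p - q) + c 8 * (a * r * s * (sq r + sq s)) + a * pow4 (r - s)
    ≡⟨ factorOutA (pow4 (p - q)) (pow4 (r - s)) ⟩
  pow4 (p - q) + a * (pow4 (r - s) + c 8 * (r * s * (sq r + sq s)))
    ≡⟨ cong (λ t → pow4 (p - q) + a * t) (sym (fourthPowerDifference r s)) ⟩
  pow4 (p - q) + a * pow4 (r + s) ∎
  where
  open ≡-Reasoning
  factorOutA : (C B : ℚ) →
    C + c 8 * (a * r * s * (sq r + sq s)) + a * B ≡
    C + a * (B + c 8 * (r * s * (sq r + sq s)))
  factorOutA C B = solve 5 (λ C B a r s →
      C :+ con (c 8) :* (a :* r :* s :* (r :* r :+ s :* s)) :+ a :* B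
      := C :+ a :* (B :+ con (c 8) :* (r :* s :* (r :* r :+ s :* s))))
    refl C B a r s

cubicIdentity : (u : ℚ) →
  pP u * qQ u * (sq (pP u) + sq (qQ u)) ≡ aA u * rR u * sS u * (sq (rR u) + sq (sS u))
cubicIdentity = solve 1 (λ u →
    let u² = u :* u
        u⁴ = u² :* u²
        p  = u :* (con (c 4) :* u⁴ :+ con (c 9) :* u² :+ con (c 4))
        q  = con (c 4) :* u⁴ :+ con (c 9) :* u² :+ con (c 6)
        r  = u :* (con (c 4) :* u⁴ :+ con (c 9) :* u² :+ con (c 6))
        s  = con (c 4) :* (u² :+ con (c 1))
        a  = u² :+ con ((+ 9) / 4)
    in p :* q :* (p :* p :+ q :* q) := a :* r :* s :* (r :* r :+ s :* s))
  refl

mainTheorem15 : (u : ℚ) →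
    (pP u * qQ u * (sq (pP u) + sq (qQ u)) ≡ aA u * rR u * sS u * (sq (rR u) + sq (sS u)))
    × (pow4 (pP u + qQ u) + aA u * pow4 (rR u - sS u) ≡ pow4 (pP u - qQ u) + aA u * pow4 (rR u + sS u))
mainTheorem15 u =
  cubicIdentity u , quarticFromCubic (pP u) (qQ u) (rR u) (sS u) (aA u) (cubicIdentity u)
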